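{- Let $0\le k\le n$, let $\sigma\in\mathcal{S}_k$ be a permutation, let $\tau\in\mathcal{C}_{n-k}$ be a nilpotent partial transformation, and let $f=\mathrm{diag}(\sigma,\tau)$. Then the stabilizer of $f$ in $\mathcal{S}_n$ under conjugation decomposes as $$\mathrm{Stab}_{\mathcal{S}_n}(f)=Z(\sigma)\times \mathrm{Stab}_{\mathcal{S}_{n-k}}(\tau),$$ where $Z(\sigma)$ is the centralizer of $\sigma$ in $\mathcal{S}_k$, $\mathrm{Stab}_{\mathcal{S}_{n-k}}(\tau)=\{\rho\in\mathcal{S}_{n-k}:\rho\tau\rho^{ -1}=\tau\}$, and $\mathcal{S}_k\times\mathcal{S}_{n-k}$ is embedded in $\mathcal{S}_n$ as the permutations preserving $\{1,\dots,k\}$ (the second factor acting on $\{k+1,\dots,n\}$ via $j\mapsto k+j$).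
   Context: $[n]=\{1,\dots,n\}$. A partial transformation of $[n]$ is a map $f\colon A\to[n]$ defined on a subset $A=\mathrm{dom}(f)\subseteq[n]$; $\mathcal{P}_n$ is the set of these, with composition $(fg)(i)=f(g(i))$, defined exactly when $i\in\mathrm{dom}(g)$ and $g(i)\in\mathrm{dom}(f)$. $\mathcal{S}_n$ acts on $\mathcal{P}_n$ by conjugation $f\mapsto\pi f\pi^{ -1}$, and $\mathrm{Stab}_{\mathcal{S}_n}(f)=\{\pi\in\mathcal{S}_n:\pi f\pi^{ -1}=f\}$. A partial transformation is nilpotent if some power of it is the empty map; $\mathcal{C}_p$ is the set of nilpotent partial transformations of $[p]$. For $\sigma\in\mathcal{S}_k$ and $\tau\in\mathcal{P}_{n-k}$, $\mathrm{diag}(\sigma,\tau)\in\mathcal{P}_n$ is the partial transformation with value $\sigma(i)$ at $1\le i\le k$, value $k+\tau(j)$ at $k+j$ for $j\in\mathrm{dom}(\tau)$, and undefined at $k+j$ for $j\notin\mathrm{dom}(\tau)$. -}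

module Defs where

open import Data.Nat using (ℕ; _+_)
open import Data.Fin using (Fin; splitAt; _↑ˡ_; _↑ʳ_)
open import Data.Maybe using (Maybe; just; nothing; _>>=_)
import Data.Maybe as Maybe
open import Data.Sum using (inj₁; inj₂)
open import Data.Product using (∃)
open import Data.Fin.Permutation using (Permutation′; _⟨$⟩ʳ_; _⟨$⟩ˡ_)
open import Relation.Binary.PropositionalEquality using (_≡_)

-- A partial transformation of [n] (points modelled by Fin n):
-- f i = nothing means i ∉ dom f.
PT : ℕ → Set
PT n = Fin n → Maybe (Fin n)

_∘ₚ_ : ∀ {n} → PT n → PT n → PT n
(f ∘ₚ g) i = g i >>= f

emptyPT : ∀ {n} → PT n
emptyPT _ = nothing

_^ₚ_ : ∀ {n} → PT n → ℕ → PT n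
(f ^ₚ ℕ.zero) i = just i
(f ^ₚ ℕ.suc m) = f ∘ₚ (f ^ₚ m)

Nilpotent : ∀ {n} → PT n → Set
Nilpotent {n} f = ∃ λ m → ∀ (i : Fin n) → (f ^ₚ m) i ≡ emptyPT i

conj : ∀ {n} → Permutation′ n → PT n → PT n
conj π f i = Maybe.map (π ⟨$⟩ʳ_) (f (π ⟨$⟩ˡ i))

InStab : ∀ {n} → Permutation′ n → PT n → Set
InStab {n} π f = ∀ (i : Fin n) → conj π f i ≡ f i

InCentralizer : ∀ {k} → Permutation′ k → Permutation′ k → Set
InCentralizer {k} ρ σ = ∀ (i : Fin k) → ρ ⟨$⟩ʳ (σ ⟨$⟩ʳ i) ≡ σ ⟨$⟩ʳ (ρ ⟨$⟩ʳ i)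

diag : ∀ {k m} → Permutation′ k → PT m → PT (k + m)
diag {k} {m} σ τ i with splitAt k i
... | inj₁ a = just ((σ ⟨$⟩ʳ a) ↑ˡ m)
... | inj₂ b = Maybe.map (k ↑ʳ_) (τ b)

embed : ∀ {k m} → Permutation′ k → Permutation′ m → Fin (k + m) → Fin (k + m)
embed {k} {m} α β i with splitAt k i
... | inj₁ a = (α ⟨$⟩ʳ a) ↑ˡ m
... | inj₂ b = k ↑ʳ (β ⟨$⟩ʳ b)

-- A permutation π fixes f = diag(σ, τ) under conjugation iff it intertwines f with itself, and then it
-- also intertwines every power of f, so it preserves the set of points on which f^N is defined. For N
-- with τ^N empty this set is exactly the block {1..k}: there f acts as the permutation σ, and on the
-- other block f^N is the empty map. Hence π preserves both blocks, i.e. π = embed α β, and on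
-- block-diagonal permutations the intertwining condition splits into α σ = σ α and β τ β⁻¹ = τ.
module Submission where

open import Defs
open import Data.Nat using (ℕ; zero; suc; _+_)
open import Data.Fin using (Fin; splitAt; _↑ˡ_; _↑ʳ_)
open import Data.Fin.Properties
  using (splitAt-↑ˡ; splitAt-↑ʳ; splitAt⁻¹-↑ˡ; splitAt⁻¹-↑ʳ; ↑ˡ-injective; ↑ʳ-injective)
open import Data.Bool using (Bool; true; false)
open import Data.Empty using (⊥-elim)
open import Data.Product using (Σ; ∃; _×_; _,_; proj₁; proj₂)
open import Data.Sum using (inj₁; inj₂)
open import Data.Maybe using (Maybe; just; nothing; is-just)
import Data.Maybe as Maybe
open import Data.Maybe.Properties using (just-injective; map-cong; map-injective; map-∘)
open import Data.Fin.Permutation using (Permutation′; _⟨$⟩ʳ_; _⟨$⟩ˡ_; permutation; flip; inverseˡ; inverseʳ)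
open import Function.Base using (_∘_)
open import Function.Bundles using (_⇔_; mk⇔; Equivalence)
open import Function.Definitions using (Injective)
open import Relation.Binary.PropositionalEquality

private
  variable
    n k m : ℕ

Intertwines : (Fin m → Fin n) → PT m → PT n → Set
Intertwines {m} g h f = ∀ (i : Fin m) → f (g i) ≡ Maybe.map g (h i)

InStab⇒Intertwines : {π : Permutation′ n} {f : PT n} → InStab π f → Intertwines (π ⟨$⟩ʳ_) f f
InStab⇒Intertwines {π = π} {f} s i = begin
  f (π ⟨$⟩ʳ i)                            ≡⟨ s (π ⟨$⟩ʳ i) ⟨
  Maybe.map (π ⟨$⟩ʳ_) (f (π ⟨$⟩ˡ (π ⟨$⟩ʳ i))) ≡⟨ cong (Maybe.map (π ⟨$⟩ʳ_) ∘ f) (inverseˡ π) ⟩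
  Maybe.map (π ⟨$⟩ʳ_) (f i)                ∎
  where open ≡-Reasoning

Intertwines⇒InStab : {π : Permutation′ n} {f : PT n} → Intertwines (π ⟨$⟩ʳ_) f f → InStab π f
Intertwines⇒InStab {π = π} {f} t i = trans (sym (t (π ⟨$⟩ˡ i))) (cong f (inverseʳ π))

Intertwines-cong : {g g′ : Fin m → Fin n} {h : PT m} {f : PT n} → (∀ i → g i ≡ g′ i) →
  Intertwines g h f → Intertwines g′ h f
Intertwines-cong {g = g} {g′} {h} {f} g≗g′ t i = begin
  f (g′ i)           ≡⟨ cong f (g≗g′ i) ⟨
  f (g i)            ≡⟨ t i ⟩
  Maybe.map g (h i)  ≡⟨ map-cong g≗g′ (h i) ⟩
  Maybe.map g′ (h i) ∎
  where open ≡-Reasoning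

Intertwines-^ₚ : {g : Fin m → Fin n} {h : PT m} {f : PT n} → Intertwines g h f →
  ∀ N → Intertwines g (h ^ₚ N) (f ^ₚ N)
Intertwines-^ₚ t zero    i = refl
Intertwines-^ₚ {g = g} {h} {f} t (suc N) i =
  trans (cong (Maybe._>>= f) (Intertwines-^ₚ t N i)) (map-bind ((h ^ₚ N) i))
  where
  map-bind : ∀ x → (Maybe.map g x Maybe.>>= f) ≡ Maybe.map g (x Maybe.>>= h)
  map-bind nothing  = refl
  map-bind (just j) = t j

is-just-map : ∀ {A B : Set} (g : A → B) (x : Maybe A) → is-just (Maybe.map g x) ≡ is-just x
is-just-map g nothing  = refl
is-just-map g (just _) = refl

is-just-^ₚ-Intertwines : {g : Fin m → Fin n} {h : PT m} {f : PT n} → Intertwines g h f →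
  ∀ N i → is-just ((f ^ₚ N) (g i)) ≡ is-just ((h ^ₚ N) i)
is-just-^ₚ-Intertwines {g = g} {h} t N i =
  trans (cong is-just (Intertwines-^ₚ t N i)) (is-just-map g ((h ^ₚ N) i))

is-just-^ₚ-total : (f : PT n) → (∀ i → is-just (f i) ≡ true) → ∀ N i → is-just ((f ^ₚ N) i) ≡ true
is-just-^ₚ-total f total zero    i = refl
is-just-^ₚ-total f total (suc N) i with (f ^ₚ N) i | is-just-^ₚ-total f total N i
... | just j | _ = total j

data SplitView (k m : ℕ) : Fin (k + m) → Set where
  left  : (a : Fin k) → SplitView k m (a ↑ˡ m)
  right : (b : Fin m) → SplitView k m (k ↑ʳ b)

splitView : (i : Fin (k + m)) → SplitView k m i
splitView {k} {m} i with splitAt k i in eq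
... | inj₁ a = subst (SplitView k m) (splitAt⁻¹-↑ˡ eq) (left a)
... | inj₂ b = subst (SplitView k m) (splitAt⁻¹-↑ʳ eq) (right b)

SeparatesBlocks : (Fin (k + m) → Bool) → Set
SeparatesBlocks {k} {m} p = (∀ a → p (a ↑ˡ m) ≡ true) × (∀ b → p (k ↑ʳ b) ≡ false)

restriction-inverse : ∀ {A B : Set} {e : A → B} {g h : B → B} {g′ h′ : A → A} →
  Injective _≡_ _≡_ e → (∀ a → g (e a) ≡ e (g′ a)) → (∀ a → h (e a) ≡ e (h′ a)) → (∀ x → h (g x) ≡ x) →
  ∀ a → h′ (g′ a) ≡ a
restriction-inverse {e = e} {g} {h} {g′} {h′} e-inj g-res h-res hg a = e-inj (begin
  e (h′ (g′ a)) ≡⟨ h-res (g′ a) ⟨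
  h (e (g′ a))  ≡⟨ cong h (g-res a) ⟨
  h (g (e a))   ≡⟨ hg (e a) ⟩
  e a           ∎)
  where open ≡-Reasoning

embed-↑ˡ : (α : Permutation′ k) (β : Permutation′ m) (a : Fin k) → embed α β (a ↑ˡ m) ≡ (α ⟨$⟩ʳ a) ↑ˡ m
embed-↑ˡ {k} {m} α β a rewrite splitAt-↑ˡ k a m = refl

embed-↑ʳ : (α : Permutation′ k) (β : Permutation′ m) (b : Fin m) → embed α β (k ↑ʳ b) ≡ k ↑ʳ (β ⟨$⟩ʳ b)
embed-↑ʳ {k} {m} α β b rewrite splitAt-↑ʳ k m b = refl

module BlockRestriction {k m : ℕ} {p : Fin (k + m) → Bool} (sep : SeparatesBlocks {k} {m} p) where

  Invariant : Permutation′ (k + m) → Set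
  Invariant π = ∀ i → p (π ⟨$⟩ʳ i) ≡ p i

  flip-invariant : (π : Permutation′ (k + m)) → Invariant π → Invariant (flip π)
  flip-invariant π inv i = trans (sym (inv (π ⟨$⟩ˡ i))) (cong p (inverseʳ π))

  ↑ʳ≢↑ˡ : ∀ a b → p (k ↑ʳ b) ≢ p (a ↑ˡ m)
  ↑ʳ≢↑ˡ a b e = false≢true (trans (sym (proj₂ sep b)) (trans e (proj₁ sep a)))
    where
    false≢true : false ≢ true
    false≢true ()

  ↑ˡ-image : (π : Permutation′ (k + m)) → Invariant π → ∀ a → ∃ λ c → π ⟨$⟩ʳ (a ↑ˡ m) ≡ c ↑ˡ m
  ↑ˡ-image π inv a with π ⟨$⟩ʳ (a ↑ˡ m) | splitView {k} {m} (π ⟨$⟩ʳ (a ↑ˡ m)) | inv (a ↑ˡ m)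
  ... | _ | left c  | _ = c , refl
  ... | _ | right b | e = ⊥-elim (↑ʳ≢↑ˡ a b e)

  ↑ʳ-image : (π : Permutation′ (k + m)) → Invariant π → ∀ b → ∃ λ c → π ⟨$⟩ʳ (k ↑ʳ b) ≡ k ↑ʳ c
  ↑ʳ-image π inv b with π ⟨$⟩ʳ (k ↑ʳ b) | splitView {k} {m} (π ⟨$⟩ʳ (k ↑ʳ b)) | inv (k ↑ʳ b)
  ... | _ | right c | _ = c , refl
  ... | _ | left a  | e = ⊥-elim (↑ʳ≢↑ˡ a b (sym e))

  restrictˡ-inverse : (π ρ : Permutation′ (k + m)) (πinv : Invariant π) (ρinv : Invariant ρ) →
    (∀ i → π ⟨$⟩ʳ (ρ ⟨$⟩ʳ i) ≡ i) → ∀ a → proj₁ (↑ˡ-image π πinv (proj₁ (↑ˡ-image ρ ρinv a))) ≡ a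
  restrictˡ-inverse π ρ πinv ρinv = restriction-inverse {e = _↑ˡ m} {ρ ⟨$⟩ʳ_} {π ⟨$⟩ʳ_}
    (↑ˡ-injective m _ _) (proj₂ ∘ ↑ˡ-image ρ ρinv) (proj₂ ∘ ↑ˡ-image π πinv)

  restrictʳ-inverse : (π ρ : Permutation′ (k + m)) (πinv : Invariant π) (ρinv : Invariant ρ) →
    (∀ i → π ⟨$⟩ʳ (ρ ⟨$⟩ʳ i) ≡ i) → ∀ b → proj₁ (↑ʳ-image π πinv (proj₁ (↑ʳ-image ρ ρinv b))) ≡ b
  restrictʳ-inverse π ρ πinv ρinv = restriction-inverse {e = k ↑ʳ_} {ρ ⟨$⟩ʳ_} {π ⟨$⟩ʳ_}
    (↑ʳ-injective k _ _) (proj₂ ∘ ↑ʳ-image ρ ρinv) (proj₂ ∘ ↑ʳ-image π πinv)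

  invariant⇒≗embed : (π : Permutation′ (k + m)) → Invariant π →
    Σ (Permutation′ k) λ α → Σ (Permutation′ m) λ β → ∀ i → π ⟨$⟩ʳ i ≡ embed α β i
  invariant⇒≗embed π inv = α , β , π≗embed
    where
    π⁻¹ = flip π
    inv⁻¹ = flip-invariant π inv

    α : Permutation′ k
    α = permutation (proj₁ ∘ ↑ˡ-image π inv) (proj₁ ∘ ↑ˡ-image π⁻¹ inv⁻¹)
      (restrictˡ-inverse π π⁻¹ inv inv⁻¹ (λ _ → inverseʳ π))
      (restrictˡ-inverse π⁻¹ π inv⁻¹ inv (λ _ → inverseˡ π))

    β : Permutation′ m
    β = permutation (proj₁ ∘ ↑ʳ-image π inv) (proj₁ ∘ ↑ʳ-image π⁻¹ inv⁻¹)
      (restrictʳ-inverse π π⁻¹ inv inv⁻¹ (λ _ → inverseʳ π))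
      (restrictʳ-inverse π⁻¹ π inv⁻¹ inv (λ _ → inverseˡ π))

    π≗embed : ∀ i → π ⟨$⟩ʳ i ≡ embed α β i
    π≗embed i with splitView {k} {m} i
    ... | left a  = trans (proj₂ (↑ˡ-image π inv a)) (sym (embed-↑ˡ α β a))
    ... | right b = trans (proj₂ (↑ʳ-image π inv b)) (sym (embed-↑ʳ α β b))

module _ {k m : ℕ} (σ : Permutation′ k) (τ : PT m) where

  diag-↑ˡ : Intertwines (_↑ˡ m) (just ∘ (σ ⟨$⟩ʳ_)) (diag σ τ)
  diag-↑ˡ a rewrite splitAt-↑ˡ k a m = refl

  diag-↑ʳ : Intertwines (k ↑ʳ_) τ (diag σ τ)
  diag-↑ʳ b rewrite splitAt-↑ʳ k m b = refl

  diag-^ₚ-separatesBlocks : ∀ N → (∀ b → (τ ^ₚ N) b ≡ nothing) →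
    SeparatesBlocks (λ i → is-just ((diag σ τ ^ₚ N) i))
  diag-^ₚ-separatesBlocks N τᴺ≡∅ = left-defined , right-undefined
    where
    left-defined : ∀ a → is-just ((diag σ τ ^ₚ N) (a ↑ˡ m)) ≡ true
    left-defined a =
      trans (is-just-^ₚ-Intertwines diag-↑ˡ N a) (is-just-^ₚ-total _ (λ _ → refl) N a)

    right-undefined : ∀ b → is-just ((diag σ τ ^ₚ N) (k ↑ʳ b)) ≡ false
    right-undefined b = trans (is-just-^ₚ-Intertwines diag-↑ʳ N b) (cong is-just (τᴺ≡∅ b))

  module _ (α : Permutation′ k) (β : Permutation′ m) where

    diag-embed-↑ˡ : ∀ a → diag σ τ (embed α β (a ↑ˡ m)) ≡ just ((σ ⟨$⟩ʳ (α ⟨$⟩ʳ a)) ↑ˡ m)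
    diag-embed-↑ˡ a = trans (cong (diag σ τ) (embed-↑ˡ α β a)) (diag-↑ˡ (α ⟨$⟩ʳ a))

    embed-diag-↑ˡ : ∀ a → Maybe.map (embed α β) (diag σ τ (a ↑ˡ m)) ≡ just ((α ⟨$⟩ʳ (σ ⟨$⟩ʳ a)) ↑ˡ m)
    embed-diag-↑ˡ a =
      trans (cong (Maybe.map (embed α β)) (diag-↑ˡ a)) (cong just (embed-↑ˡ α β (σ ⟨$⟩ʳ a)))

    diag-embed-↑ʳ : ∀ b → diag σ τ (embed α β (k ↑ʳ b)) ≡ Maybe.map (k ↑ʳ_) (τ (β ⟨$⟩ʳ b))
    diag-embed-↑ʳ b = trans (cong (diag σ τ) (embed-↑ʳ α β b)) (diag-↑ʳ (β ⟨$⟩ʳ b))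

    embed-diag-↑ʳ : ∀ b → Maybe.map (embed α β) (diag σ τ (k ↑ʳ b)) ≡
      Maybe.map (k ↑ʳ_) (Maybe.map (β ⟨$⟩ʳ_) (τ b))
    embed-diag-↑ʳ b = begin
      Maybe.map (embed α β) (diag σ τ (k ↑ʳ b))            ≡⟨ cong (Maybe.map (embed α β)) (diag-↑ʳ b) ⟩
      Maybe.map (embed α β) (Maybe.map (k ↑ʳ_) (τ b))      ≡⟨ map-∘ (τ b) ⟨
      Maybe.map (embed α β ∘ (k ↑ʳ_)) (τ b)                ≡⟨ map-cong (embed-↑ʳ α β) (τ b) ⟩
      Maybe.map ((k ↑ʳ_) ∘ (β ⟨$⟩ʳ_)) (τ b)                ≡⟨ map-∘ (τ b) ⟩
      Maybe.map (k ↑ʳ_) (Maybe.map (β ⟨$⟩ʳ_) (τ b))        ∎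
      where open ≡-Reasoning

    embed-Intertwines-diag⇔ : Intertwines (embed α β) (diag σ τ) (diag σ τ) ⇔
      (InCentralizer α σ × Intertwines (β ⟨$⟩ʳ_) τ τ)
    embed-Intertwines-diag⇔ = mk⇔ split join
      where
      split : Intertwines (embed α β) (diag σ τ) (diag σ τ) →
        InCentralizer α σ × Intertwines (β ⟨$⟩ʳ_) τ τ
      split t = centralizes , β-intertwines
        where
        centralizes : InCentralizer α σ
        centralizes a = ↑ˡ-injective m _ _ (just-injective
          (trans (sym (embed-diag-↑ˡ a)) (trans (sym (t (a ↑ˡ m))) (diag-embed-↑ˡ a))))

        β-intertwines : Intertwines (β ⟨$⟩ʳ_) τ τ
        β-intertwines b = map-injective (↑ʳ-injective k _ _)
          (trans (sym (diag-embed-↑ʳ b)) (trans (t (k ↑ʳ b)) (embed-diag-↑ʳ b)))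

      join : InCentralizer α σ × Intertwines (β ⟨$⟩ʳ_) τ τ →
        Intertwines (embed α β) (diag σ τ) (diag σ τ)
      join (centralizes , β-intertwines) i with splitView {k} {m} i
      ... | left a  = trans (diag-embed-↑ˡ a)
        (trans (cong (λ c → just (c ↑ˡ m)) (sym (centralizes a))) (sym (embed-diag-↑ˡ a)))
      ... | right b = trans (diag-embed-↑ʳ b)
        (trans (cong (Maybe.map (k ↑ʳ_)) (β-intertwines b)) (sym (embed-diag-↑ʳ b)))

theorem3p2 : (k m : ℕ) (σ : Permutation′ k) (τ : PT m) → Nilpotent τ →
    (π : Permutation′ (k + m)) →
      InStab π (diag σ τ) ⇔
        Σ (Permutation′ k) (λ α → Σ (Permutation′ m) (λ β →
          (InCentralizer α σ × InStab β τ) ×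
          (∀ (i : Fin (k + m)) → π ⟨$⟩ʳ i ≡ embed α β i)))
theorem3p2 k m σ τ (N , τᴺ≡∅) π =
  mk⇔ (decompose ∘ InStab⇒Intertwines {π = π}) (Intertwines⇒InStab {π = π} ∘ compose)
  where
  f : PT (k + m)
  f = diag σ τ

  open BlockRestriction {p = λ i → is-just ((f ^ₚ N) i)} (diag-^ₚ-separatesBlocks σ τ N τᴺ≡∅)

  Decomposition : Set
  Decomposition = Σ (Permutation′ k) (λ α → Σ (Permutation′ m) (λ β →
    (InCentralizer α σ × InStab β τ) × (∀ i → π ⟨$⟩ʳ i ≡ embed α β i)))

  decompose : Intertwines (π ⟨$⟩ʳ_) f f → Decomposition
  decompose t
    with α , β , π≗embed ← invariant⇒≗embed π (is-just-^ₚ-Intertwines t N)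
    with centralizes , β-intertwines ← Equivalence.to (embed-Intertwines-diag⇔ σ τ α β)
                                         (Intertwines-cong {h = f} {f} π≗embed t)
    = α , β , (centralizes , Intertwines⇒InStab {π = β} β-intertwines) , π≗embed

  compose : Decomposition → Intertwines (π ⟨$⟩ʳ_) f f
  compose (α , β , (centralizes , β-stab) , π≗embed) = Intertwines-cong {h = f} {f} (sym ∘ π≗embed)
    (Equivalence.from (embed-Intertwines-diag⇔ σ τ α β) (centralizes , InStab⇒Intertwines {π = β} β-stab))
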